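{- Let $p$ be a prime and let $q\in\mathbb{Z}_p$ with $|q|_p<1$. Let $(a_n)_{n\ge1}$ be the canonical sequence of $q$ and $\Gamma_q=\sum_{n\ge1}\frac{a_n}{p^n}\mathbb{Z}\subset\mathbb{Q}$. Then $\Gamma_q/\mathbb{Z}\cong\mathbb{Z}(p^\infty)$.
   Context: The canonical sequence of $q\in\mathbb{Z}_p$ is the sequence of integers $a_n$ with $0\le a_n\le p^n-1$ and $q\equiv a_n\pmod{p^n\mathbb{Z}_p}$. $\mathbb{Z}(p^\infty)$ denotes the quasicyclic (Prüfer) group $\langle \gamma_1,\gamma_2,\dots \mid p\gamma_1=0,\ p\gamma_2=\gamma_1,\ p\gamma_3=\gamma_2,\dots\rangle$ (abelian presentation). -}

module Defs where

open import Level using (0ℓ)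
open import Data.Nat as ℕ using (ℕ; zero; suc; _<_; _^_; NonZero)
open import Data.Nat.Properties using (m^n≢0)
open import Data.Nat.Primality using (Prime; prime⇒nonZero)
open import Data.Integer as ℤ using (ℤ; +_)
open import Data.Rational as ℚ using (ℚ; _/_; _+_; _-_; _*_; 0ℚ)
open import Data.List using (List; []; _∷_)
open import Data.Product using (Σ; ∃; _×_)
open import Relation.Binary.PropositionalEquality using (_≡_)
open import Algebra.Bundles using (AbelianGroup)

-- ℤ_p as the inverse limit of ℤ/p^n: an element q is given by its
-- canonical sequence (a_n), 0 ≤ a_n < p^n, a_{n+1} ≡ a_n (mod p^n).
-- (Index 0 is included; the conditions force a 0 = 0.)
IsCanonicalSeq : ℕ → (ℕ → ℕ) → Set
IsCanonicalSeq p a =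
  (∀ n → a n < p ^ n) × (∀ n → ∃ λ k → a (suc n) ≡ ℕ._+_ (a n) (ℕ._*_ k (p ^ n)))

ℤₚ : ℕ → Set
ℤₚ p = Σ (ℕ → ℕ) (IsCanonicalSeq p)

canonical : ∀ {p} → ℤₚ p → ℕ → ℕ
canonical q = Data.Product.proj₁ q

-- |q|_p < 1  iff  q ∈ pℤ_p  iff  q ≡ 0 mod p  iff a_1 = 0
NormLt1 : ∀ {p} → ℤₚ p → Set
NormLt1 q = canonical q 1 ≡ 0

frac : (p : ℕ) → Prime p → ℤ → ℕ → ℚ
frac p pp m n = _/_ m (p ^ n) {{m^n≢0 p n {{prime⇒nonZero pp}}}}

combo : (p : ℕ) → Prime p → (ℕ → ℕ) → List ℤ → ℕ → ℚ
combo p pp a []       n = 0ℚ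
combo p pp a (c ∷ cs) n = frac p pp (ℤ._*_ c (+ a n)) n + combo p pp a cs (suc n)

InΓ : (p : ℕ) → Prime p → (ℕ → ℕ) → ℚ → Set
InΓ p pp a x = ∃ λ (cs : List ℤ) → x ≡ combo p pp a cs 1

IsInt : ℚ → Set
IsInt x = ∃ λ (z : ℤ) → x ≡ z / 1

ℕ→ℚ : ℕ → ℚ
ℕ→ℚ n = (+ n) / 1

module _ (A : AbelianGroup 0ℓ 0ℓ) where
  open AbelianGroup A
  mult : ℕ → Carrier → Carrier
  mult zero    x = ε
  mult (suc n) x = x ∙ mult n x

-- elements γ_1, γ_2, … (indexed from 0) of A satisfying
-- p γ_1 = 0, p γ_{n+1} = γ_n
PruferRelations : (p : ℕ) (A : AbelianGroup 0ℓ 0ℓ) → (ℕ → AbelianGroup.Carrier A) → Set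
PruferRelations p A b =
  (mult A p (b 0) ≈ ε) × (∀ n → mult A p (b (suc n)) ≈ b n)
  where open AbelianGroup A

-- a group homomorphism Γ_q/ℤ → A, given on representatives x ∈ Γ_q
record HomΓmodℤ (p : ℕ) (pp : Prime p) (a : ℕ → ℕ) (A : AbelianGroup 0ℓ 0ℓ) : Set where
  open AbelianGroup A using (Carrier; _≈_; _∙_)
  field
    f        : (x : ℚ) → InΓ p pp a x → Carrier
    respects : ∀ x y (hx : InΓ p pp a x) (hy : InΓ p pp a y) →
               IsInt (x ℚ.- y) → f x hx ≈ f y hy
    additive : ∀ x y (hx : InΓ p pp a x) (hy : InΓ p pp a y) (hxy : InΓ p pp a (x ℚ.+ y)) →
               f (x ℚ.+ y) hxy ≈ (f x hx ∙ f y hy)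

-- Γ_q/ℤ ≅ ⟨γ_1, γ_2, … | pγ_1 = 0, pγ_{n+1} = γ_n⟩ (abelian presentation):
-- the classes of g 0, g 1, … satisfy the relations and have the universal
-- property of the presented abelian group.
PresentsPrufer : (p : ℕ) (pp : Prime p) (a : ℕ → ℕ) (g : ℕ → ℚ) → (∀ n → InΓ p pp a (g n)) → Set₁
PresentsPrufer p pp a g hg =
  (IsInt (ℕ→ℚ p * g 0) × (∀ n → IsInt ((ℕ→ℚ p * g (suc n)) - g n))) ×
  ((A : AbelianGroup 0ℓ 0ℓ) (b : ℕ → AbelianGroup.Carrier A) → PruferRelations p A b →
     (Σ (HomΓmodℤ p pp a A) λ φ → ∀ n →
          AbelianGroup._≈_ A (HomΓmodℤ.f φ (g n) (hg n)) (b n))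
   × ((φ ψ : HomΓmodℤ p pp a A) →
        (∀ n → AbelianGroup._≈_ A (HomΓmodℤ.f φ (g n) (hg n)) (b n)) →
        (∀ n → AbelianGroup._≈_ A (HomΓmodℤ.f ψ (g n) (hg n)) (b n)) →
        ∀ x (hx : InΓ p pp a x) → AbelianGroup._≈_ A (HomΓmodℤ.f φ x hx) (HomΓmodℤ.f ψ x hx)))

-- Let a_{k+1} be the first nonzero digit of q (a_0 = 0 always). Since a_{m+1} ≡ a_m (mod p^m), we have
-- p · a_{m+1}/p^{m+1} ≡ a_m/p^m modulo ℤ, so the classes of g_n = a_{n+1+k}/p^{n+1+k} satisfy the Prüfer
-- relations (p g_0 ≡ a_k/p^k = 0). Given b_n satisfying them in A, a_i/p^i must go to h_i, where h_i = 0
-- for i ≤ k and h_{n+1+k} = b_n, so that h_i = p^{M-i} h_M. Over the common denominator p^M a combination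
-- Σ c_i a_i/p^i is congruent mod ℤ to W a_M/p^M with W = Σ c_i p^{M-i}, and it goes to W h_M. This is well
-- defined: a_M = p^k v with p ∤ v, so if W a_M/p^M ∈ ℤ then p^{M-k} ∣ W, and p^{M-k} h_M = h_k = 0.
module Submission where

open import Defs
open import Data.Nat using (ℕ)
open import Relation.Binary.PropositionalEquality using (_≢_)
open import Data.Nat.Primality using (Prime)
open import Data.Rational using (ℚ)
open import Data.Product using (Σ; ∃)

open import Data.Product using (_,_; proj₁)
import Data.Nat.Properties as ℕP
open import Algebra.Bundles using (AbelianGroup)

module Fractions where
  open import Data.Nat as ℕ using (ℕ; suc; NonZero)
  import Data.Nat.Properties as ℕP
  open import Data.Integer as ℤ using (ℤ; +_)
  import Data.Integer.Properties as ℤP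
  open import Data.Integer.Tactic.RingSolver using (solve-∀)
  open import Data.Rational as ℚ using (ℚ; toℚᵘ)
  import Data.Rational.Properties as ℚP
  open import Data.Rational.Unnormalised as ℚᵘ using (*≡*) renaming (_≃_ to _≃ᵘ_)
  import Data.Rational.Unnormalised.Properties as ℚᵘP
  open import Data.Product using (∃; _,_)
  open import Relation.Binary.PropositionalEquality

  infix 4 _≃_÷_

  _≃_÷_ : ℚ → ℤ → (D : ℕ) → .{{NonZero D}} → Set
  x ≃ N ÷ D = toℚᵘ x ≃ᵘ N ℚᵘ./ D

  /-≃÷ : ∀ z D .{{_ : NonZero D}} → z ℚ./ D ≃ z ÷ D
  /-≃÷ z (suc d) = ℚP.toℚᵘ-fromℚᵘ (ℚᵘ.mkℚᵘ z d)

  ≃÷-injective : ∀ {x y N D} .{{_ : NonZero D}} → x ≃ N ÷ D → y ≃ N ÷ D → x ≡ y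
  ≃÷-injective x≃ y≃ = ℚP.toℚᵘ-injective (ℚᵘP.≃-trans x≃ (ℚᵘP.≃-sym y≃))

  ≃÷-rescale : ∀ {x N M D E} .{{_ : NonZero D}} .{{_ : NonZero E}} →
               x ≃ N ÷ D → N ℤ.* + E ≡ M ℤ.* + D → x ≃ M ÷ E
  ≃÷-rescale {D = suc _} {E = suc _} x≃ eq = ℚᵘP.≃-trans x≃ (*≡* eq)

  ≃÷-+ : ∀ {x y N M D} .{{_ : NonZero D}} → x ≃ N ÷ D → y ≃ M ÷ D → x ℚ.+ y ≃ N ℤ.+ M ÷ D
  ≃÷-+ {x} {y} {N} {M} {D@(suc d)} x≃ y≃ =
    ℚᵘP.≃-trans (ℚP.toℚᵘ-homo-+ x y) (ℚᵘP.≃-trans (ℚᵘP.+-cong x≃ y≃) (*≡* (add-same-denominator N M (+ D))))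
    where
    add-same-denominator : ∀ N M D → (N ℤ.* D ℤ.+ M ℤ.* D) ℤ.* D ≡ (N ℤ.+ M) ℤ.* (D ℤ.* D)
    add-same-denominator = solve-∀

  ≃÷-neg : ∀ {x N D} .{{_ : NonZero D}} → x ≃ N ÷ D → ℚ.- x ≃ ℤ.- N ÷ D
  ≃÷-neg {x} {D = suc _} x≃ = ℚᵘP.≃-trans (ℚP.toℚᵘ-homo‿- x) (ℚᵘP.-‿cong x≃)

  ≃÷-- : ∀ {x y N M D} .{{_ : NonZero D}} → x ≃ N ÷ D → y ≃ M ÷ D → x ℚ.- y ≃ N ℤ.- M ÷ D
  ≃÷-- x≃ y≃ = ≃÷-+ x≃ (≃÷-neg y≃)

  ≃÷-* : ∀ {x y N M D E} .{{_ : NonZero D}} .{{_ : NonZero E}} →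
         x ≃ N ÷ D → y ≃ M ÷ E → (x ℚ.* y ≃ N ℤ.* M ÷ D ℕ.* E) {{ℕP.m*n≢0 D E}}
  ≃÷-* {x} {y} {D = suc _} {E = suc _} x≃ y≃ = ℚᵘP.≃-trans (ℚP.toℚᵘ-homo-* x y) (ℚᵘP.*-cong x≃ y≃)

  ≃÷-IsInt⇒ : ∀ {x N D} .{{_ : NonZero D}} → x ≃ N ÷ D → IsInt x → ∃ λ w → N ≡ w ℤ.* + D
  ≃÷-IsInt⇒ {N = N} {D = suc _} x≃ (w , refl) with ℚᵘP.≃-trans (ℚᵘP.≃-sym x≃) (/-≃÷ w 1)
  ... | *≡* eq = w , trans (sym (ℤP.*-identityʳ N)) eq

  ≃÷-IsInt⇐ : ∀ {x N D w} .{{_ : NonZero D}} → x ≃ N ÷ D → N ≡ w ℤ.* + D → IsInt x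
  ≃÷-IsInt⇐ {N = N} {w = w} x≃ refl =
    w , ≃÷-injective x≃ (≃÷-rescale (/-≃÷ w 1) (sym (ℤP.*-identityʳ _)))

  x-x-integral : ∀ x → IsInt (x ℚ.- x)
  x-x-integral x = + 0 , ℚP.+-inverseʳ x

  0ℚ-≃÷ : ∀ D .{{_ : NonZero D}} → ℚ.0ℚ ≃ + 0 ÷ D
  0ℚ-≃÷ (suc _) = *≡* refl

  ≃÷-*ˡ : ∀ z {x N D} .{{_ : NonZero D}} → x ≃ N ÷ D → (z ℚ./ 1) ℚ.* x ≃ z ℤ.* N ÷ D
  ≃÷-*ˡ z {N = N} {D} x≃ =
    ≃÷-rescale {{ℕP.m*n≢0 1 D}} (≃÷-* (/-≃÷ z 1) x≃) (cong (λ E → z ℤ.* N ℤ.* + E) (sym (ℕP.*-identityˡ D)))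

module GroupMultiples where
  open import Level using (Level; 0ℓ)
  open import Data.Nat as ℕ using (ℕ; zero; suc)
  import Data.Nat.Properties as ℕP
  open import Data.Integer as ℤ using (ℤ; +_; -[1+_]; _⊖_)
  import Data.Integer.Properties as ℤP
  open import Relation.Binary.PropositionalEquality as ≡ using (_≡_)
  open import Algebra.Bundles using (AbelianGroup)

  module IntegerMultiples {c ℓ : Level} (A : AbelianGroup c ℓ) where
    open AbelianGroup A
    open import Algebra.Properties.AbelianGroup A using (⁻¹-∙-comm)
    open import Algebra.Properties.Group group using (ε⁻¹≈ε)
    open import Algebra.Properties.CommutativeMonoid.Mult commutativeMonoid public
    open import Algebra.Properties.CommutativeSemigroup commutativeSemigroup using (interchange)
    open import Relation.Binary.Reasoning.Setoid setoid

    infixr 8 _⊛_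

    _⊛_ : ℤ → Carrier → Carrier
    (+ n)    ⊛ x = n × x
    -[1+ n ] ⊛ x = (suc n × x) ⁻¹

    ×-ε : ∀ n → n × ε ≈ ε
    ×-ε zero    = refl
    ×-ε (suc n) = trans (identityˡ _) (×-ε n)

    ⊛-congʳ : ∀ z {x y} → x ≈ y → z ⊛ x ≈ z ⊛ y
    ⊛-congʳ (+ n)    x≈y = ×-congʳ n x≈y
    ⊛-congʳ -[1+ n ] x≈y = ⁻¹-cong (×-congʳ (suc n) x≈y)

    ⊛-ε : ∀ z → z ⊛ ε ≈ ε
    ⊛-ε (+ n)    = ×-ε n
    ⊛-ε -[1+ n ] = trans (⁻¹-cong (×-ε (suc n))) ε⁻¹≈ε

    ⊛-⊖ : ∀ m n x → (m ⊖ n) ⊛ x ≈ m × x ∙ (n × x) ⁻¹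
    ⊛-⊖ zero    zero    x = sym (trans (∙-congˡ ε⁻¹≈ε) (identityʳ ε))
    ⊛-⊖ (suc m) zero    x = sym (trans (∙-congˡ ε⁻¹≈ε) (identityʳ _))
    ⊛-⊖ zero    (suc n) x = sym (identityˡ _)
    ⊛-⊖ (suc m) (suc n) x = begin
      (suc m ⊖ suc n) ⊛ x          ≡⟨ ≡.cong (_⊛ x) (ℤP.[1+m]⊖[1+n]≡m⊖n m n) ⟩
      (m ⊖ n) ⊛ x                  ≈⟨ ⊛-⊖ m n x ⟩
      m × x ∙ (n × x) ⁻¹           ≈⟨ identityˡ _ ⟨
      ε ∙ (m × x ∙ (n × x) ⁻¹)     ≈⟨ ∙-congʳ (inverseʳ x) ⟨
      (x ∙ x ⁻¹) ∙ (m × x ∙ (n × x) ⁻¹) ≈⟨ interchange _ _ _ _ ⟩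
      suc m × x ∙ (x ⁻¹ ∙ (n × x) ⁻¹) ≈⟨ ∙-congˡ (⁻¹-∙-comm _ _) ⟩
      suc m × x ∙ (suc n × x) ⁻¹   ∎

    ⊛-homo-+ : ∀ z w x → (z ℤ.+ w) ⊛ x ≈ z ⊛ x ∙ w ⊛ x
    ⊛-homo-+ (+ m)    (+ n)    x = ×-homo-+ x m n
    ⊛-homo-+ (+ m)    -[1+ n ] x = ⊛-⊖ m (suc n) x
    ⊛-homo-+ -[1+ m ] (+ n)    x = trans (⊛-⊖ n (suc m) x) (comm _ _)
    ⊛-homo-+ -[1+ m ] -[1+ n ] x = begin
      (suc (suc m ℕ.+ n) × x) ⁻¹         ≡⟨ ≡.cong (λ k → (suc k × x) ⁻¹) (ℕP.+-suc m n) ⟨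
      ((suc m ℕ.+ suc n) × x) ⁻¹         ≈⟨ ⁻¹-cong (×-homo-+ x (suc m) (suc n)) ⟩
      (suc m × x ∙ suc n × x) ⁻¹         ≈⟨ ⁻¹-∙-comm _ _ ⟨
      (suc m × x) ⁻¹ ∙ (suc n × x) ⁻¹    ∎

    ⊛-neg : ∀ n x → (ℤ.- + n) ⊛ x ≈ (n × x) ⁻¹
    ⊛-neg zero    x = sym ε⁻¹≈ε
    ⊛-neg (suc n) x = refl

    ⊛-*-× : ∀ z n x → (z ℤ.* + n) ⊛ x ≈ z ⊛ (n × x)
    ⊛-*-× (+ m) n x = begin
      (+ m ℤ.* + n) ⊛ x  ≡⟨ ≡.cong (_⊛ x) (ℤP.pos-* m n) ⟨
      (m ℕ.* n) × x      ≈⟨ ×-assocˡ x m n ⟨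
      m × n × x          ∎
    ⊛-*-× -[1+ m ] n x = begin
      (-[1+ m ] ℤ.* + n) ⊛ x       ≡⟨ ≡.cong (_⊛ x) -[1+m]*n≡-[[1+m]*n] ⟩
      (ℤ.- + (suc m ℕ.* n)) ⊛ x    ≈⟨ ⊛-neg (suc m ℕ.* n) x ⟩
      ((suc m ℕ.* n) × x) ⁻¹       ≈⟨ ⁻¹-cong (×-assocˡ x (suc m) n) ⟨
      (suc m × n × x) ⁻¹           ∎
      where
      -[1+m]*n≡-[[1+m]*n] : -[1+ m ] ℤ.* + n ≡ ℤ.- + (suc m ℕ.* n)
      -[1+m]*n≡-[[1+m]*n] = ≡.trans (≡.sym (ℤP.neg-distribˡ-* (+ suc m) (+ n))) (≡.cong ℤ.-_ (≡.sym (ℤP.pos-* (suc m) n)))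

  module _ (A : AbelianGroup 0ℓ 0ℓ) where
    open AbelianGroup A
    open IntegerMultiples A using (_×_)

    mult≈× : ∀ n x → mult A n x ≈ n × x
    mult≈× zero    x = refl
    mult≈× (suc n) x = ∙-congˡ (mult≈× n x)

module Valuations where
  open import Data.Nat as ℕ using (ℕ; zero; suc; _+_; _*_; _^_; _≤_; _<_; NonZero)
  import Data.Nat.Properties as ℕP
  open import Data.Nat.Divisibility
    using (_∣_; divides; ∣-trans; m∣m*n; n∣m*n; ∣m+n∣m⇒∣n; ∣⇒≤; 1∣_; *-cancelˡ-∣; *-monoʳ-∣)
  open import Data.Nat.Primality using (Prime; prime⇒nonZero; euclidsLemma)
  open import Data.Nat.Tactic.RingSolver using (solve-∀)
  open import Data.Integer as ℤ using (ℤ; +_; -[1+_]; ∣_∣)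
  import Data.Integer.Properties as ℤP
  open import Data.Product using (∃; _×_; _,_; proj₁; proj₂)
  open import Data.Sum using (inj₁; inj₂)
  open import Relation.Nullary using (¬_; contradiction)
  open import Function using (_∘_)
  open import Relation.Binary.PropositionalEquality

  ∣abs⇒multiple : ∀ D P → P ∣ ∣ D ∣ → ∃ λ u → D ≡ u ℤ.* + P
  ∣abs⇒multiple (+ n)    P (divides q eq) = + q , trans (cong +_ eq) (ℤP.pos-* q P)
  ∣abs⇒multiple -[1+ n ] P (divides q eq) =
    ℤ.- + q , trans (cong ℤ.-_ (trans (cong +_ eq) (ℤP.pos-* q P))) (ℤP.neg-distribˡ-* (+ q) (+ P))

  module _ {p : ℕ} (pp : Prime p) where

    prime^∣-cancelˡ : ∀ e {v c} → ¬ p ∣ v → p ^ e ∣ v * c → p ^ e ∣ c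
    prime^∣-cancelˡ zero    {c = c} _   _ = 1∣ c
    prime^∣-cancelˡ (suc e) {v} {c} p∤v p^[1+e]∣vc with euclidsLemma v c pp (∣-trans (m∣m*n (p ^ e)) p^[1+e]∣vc)
    ... | inj₁ p∣v = contradiction p∣v p∤v
    ... | inj₂ (divides c′ refl) =
      subst (p * p ^ e ∣_) (ℕP.*-comm p c′) (*-monoʳ-∣ p (prime^∣-cancelˡ e p∤v p^e∣vc′))
      where
      rearrange : ∀ v c p → v * (c * p) ≡ p * (v * c)
      rearrange = solve-∀
      p^e∣vc′ : p ^ e ∣ v * c′
      p^e∣vc′ = *-cancelˡ-∣ p {{prime⇒nonZero pp}}
        (subst (p * p ^ e ∣_) (rearrange v c′ p) p^[1+e]∣vc)

  module CanonicalSequence {p : ℕ} (pp : Prime p) {a : ℕ → ℕ} (canon : IsCanonicalSeq p a) where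
    open ≡-Reasoning

    p^≢0 : ∀ n → NonZero (p ^ n)
    p^≢0 n = ℕP.m^n≢0 p n {{prime⇒nonZero pp}}

    a-≡-mod : ∀ n d → ∃ λ s → a (n + d) ≡ a n + s * p ^ n
    a-≡-mod n zero = 0 , trans (cong a (ℕP.+-identityʳ n)) (sym (ℕP.+-identityʳ (a n)))
    a-≡-mod n (suc d) with a-≡-mod n d | proj₂ canon (n + d)
    ... | s , a[n+d] | t , a[1+n+d] = s + t * p ^ d , (begin
        a (n + suc d)                       ≡⟨ cong a (ℕP.+-suc n d) ⟩
        a (suc (n + d))                     ≡⟨ a[1+n+d] ⟩
        a (n + d) + t * p ^ (n + d)         ≡⟨ cong₂ _+_ a[n+d] (cong (t *_) (ℕP.^-distribˡ-+-* p n d)) ⟩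
        a n + s * p ^ n + t * (p ^ n * p ^ d) ≡⟨ collect (a n) s t (p ^ n) (p ^ d) ⟩
        a n + (s + t * p ^ d) * p ^ n       ∎)
      where
      collect : ∀ x s t P Q → x + s * P + t * (P * Q) ≡ x + (s + t * Q) * P
      collect = solve-∀

    module FirstNonzero (k : ℕ) (a≡0 : ∀ j → j ≤ k → a j ≡ 0) (a[1+k]≢0 : a (suc k) ≢ 0) where

      a-valuation : ∀ j → ∃ λ v → a (suc j + k) ≡ p ^ k * v × ¬ p ∣ v
      a-valuation j with proj₂ canon k | a-≡-mod (suc k) j
      ... | s , a[1+k]≡ | t , a[1+k+j]≡ = s + t * p , a[1+j+k]≡p^k[s+tp] , p∤s+tp
        where
        factor : ∀ s P t p → s * P + t * (p * P) ≡ P * (s + t * p)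
        factor = solve-∀
        a[1+k]≡sp^k : a (suc k) ≡ s * p ^ k
        a[1+k]≡sp^k = trans a[1+k]≡ (cong (_+ s * p ^ k) (a≡0 k ℕP.≤-refl))
        a[1+j+k]≡p^k[s+tp] : a (suc j + k) ≡ p ^ k * (s + t * p)
        a[1+j+k]≡p^k[s+tp] = begin
          a (suc (j + k))           ≡⟨ cong (a ∘ suc) (ℕP.+-comm j k) ⟩
          a (suc k + j)             ≡⟨ a[1+k+j]≡ ⟩
          a (suc k) + t * p ^ suc k ≡⟨ cong (_+ t * p ^ suc k) a[1+k]≡sp^k ⟩
          s * p ^ k + t * (p * p ^ k) ≡⟨ factor s (p ^ k) t p ⟩
          p ^ k * (s + t * p)       ∎
        s<p : s < p
        s<p = ℕP.*-cancelʳ-< (p ^ k) s p (subst (_< p ^ suc k) a[1+k]≡sp^k (proj₁ canon (suc k)))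
        s≢0 : s ≢ 0
        s≢0 refl = a[1+k]≢0 a[1+k]≡sp^k
        p∤s+tp : ¬ p ∣ s + t * p
        p∤s+tp p∣s+tp = ℕP.<⇒≱ s<p (∣⇒≤ {{ℕ.≢-nonZero s≢0}}
          (∣m+n∣m⇒∣n (subst (p ∣_) (ℕP.+-comm s (t * p)) p∣s+tp) (n∣m*n t)))

      a-cancel-mod-p^ : ∀ j D W → + a (suc j + k) ℤ.* D ≡ W ℤ.* + p ^ (suc j + k) →
                        ∃ λ u → D ≡ u ℤ.* + p ^ suc j
      a-cancel-mod-p^ j D W aD≡Wp^ with a-valuation j
      ... | v , a≡p^kv , p∤v =
        ∣abs⇒multiple D (p ^ suc j) (prime^∣-cancelˡ pp (suc j) p∤v (divides ∣ W ∣ v∣D∣≡∣W∣p^[1+j]))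
        where
        v∣D∣≡∣W∣p^[1+j] : v * ∣ D ∣ ≡ ∣ W ∣ * p ^ suc j
        v∣D∣≡∣W∣p^[1+j] = ℕP.*-cancelˡ-≡ (v * ∣ D ∣) (∣ W ∣ * p ^ suc j) (p ^ k) {{p^≢0 k}} (begin
          p ^ k * (v * ∣ D ∣)         ≡⟨ ℕP.*-assoc (p ^ k) v ∣ D ∣ ⟨
          p ^ k * v * ∣ D ∣           ≡⟨ cong (_* ∣ D ∣) a≡p^kv ⟨
          a (suc j + k) * ∣ D ∣       ≡⟨ ℤP.abs-* (+ a (suc j + k)) D ⟨
          ∣ + a (suc j + k) ℤ.* D ∣   ≡⟨ cong ∣_∣ aD≡Wp^ ⟩
          ∣ W ℤ.* + p ^ (suc j + k) ∣ ≡⟨ ℤP.abs-* W (+ p ^ (suc j + k)) ⟩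
          ∣ W ∣ * p ^ (suc j + k)     ≡⟨ cong (∣ W ∣ *_) (ℕP.^-distribˡ-+-* p (suc j) k) ⟩
          ∣ W ∣ * (p ^ suc j * p ^ k) ≡⟨ shuffle ∣ W ∣ (p ^ suc j) (p ^ k) ⟩
          p ^ k * (∣ W ∣ * p ^ suc j) ∎)
          where
          shuffle : ∀ w P Q → w * (P * Q) ≡ Q * (w * P)
          shuffle = solve-∀

module CommonDenominator where
  open Fractions
  open Valuations
  open import Data.Nat using (ℕ; zero; suc; _+_; _*_; _^_; _∸_; _≤_; s≤s)
  import Data.Nat.Properties as ℕP
  open import Data.Nat.Primality using (Prime)
  open import Data.Integer as ℤ using (ℤ; +_)
  import Data.Integer.Properties as ℤP
  open import Data.Integer.Tactic.RingSolver using (solve-∀)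
  open import Data.Rational as ℚ using (ℚ; 0ℚ)
  import Data.Rational.Properties as ℚP
  open import Data.List using (List; []; _∷_; length; replicate; _++_)
  open import Data.Product using (∃; _,_; proj₂)
  open import Relation.Binary.PropositionalEquality

  module Γ-Arithmetic {p : ℕ} (pp : Prime p) {a : ℕ → ℕ} (canon : IsCanonicalSeq p a) where
    open CanonicalSequence pp canon

    frac-≃÷ : ∀ z n → (frac p pp z n ≃ z ÷ p ^ n) {{p^≢0 n}}
    frac-≃÷ z n = /-≃÷ z (p ^ n) {{p^≢0 n}}

    frac-0 : ∀ n → frac p pp (+ 0) n ≡ 0ℚ
    frac-0 n = ℚP.0/n≡0 (p ^ n) {{p^≢0 n}}

    frac-+ : ∀ x y n → frac p pp (x ℤ.+ y) n ≡ frac p pp x n ℚ.+ frac p pp y n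
    frac-+ x y n = ≃÷-injective {{p^≢0 n}} (frac-≃÷ (x ℤ.+ y) n) (≃÷-+ {{p^≢0 n}} (frac-≃÷ x n) (frac-≃÷ y n))

    combo-zeros++ : ∀ r cs m → combo p pp a (replicate r (+ 0) ++ cs) m ≡ combo p pp a cs (m + r)
    combo-zeros++ zero    cs m = cong (combo p pp a cs) (sym (ℕP.+-identityʳ m))
    combo-zeros++ (suc r) cs m = begin
      frac p pp (+ 0) m ℚ.+ combo p pp a (replicate r (+ 0) ++ cs) (suc m)
        ≡⟨ cong₂ ℚ._+_ (frac-0 m) (combo-zeros++ r cs (suc m)) ⟩
      0ℚ ℚ.+ combo p pp a cs (suc m + r)  ≡⟨ ℚP.+-identityˡ _ ⟩
      combo p pp a cs (suc (m + r))       ≡⟨ cong (combo p pp a cs) (ℕP.+-suc m r) ⟨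
      combo p pp a cs (m + suc r)         ∎
      where open ≡-Reasoning

    numerator weight : List ℤ → ℕ → ℕ → ℤ
    numerator []       n M = + 0
    numerator (c ∷ cs) n M = c ℤ.* + a n ℤ.* + p ^ (M ∸ n) ℤ.+ numerator cs (suc n) M
    weight    []       n M = + 0
    weight    (c ∷ cs) n M = c ℤ.* + p ^ (M ∸ n) ℤ.+ weight cs (suc n) M

    head≤ : ∀ L n M → suc L + n ≤ suc M → n ≤ M
    head≤ L n M (s≤s L+n≤M) = ℕP.≤-trans (ℕP.m≤n+m n L) L+n≤M

    tail≤ : ∀ L n M → suc L + n ≤ suc M → L + suc n ≤ suc M
    tail≤ L n M = subst (_≤ suc M) (sym (ℕP.+-suc L n))

    private
      p^-split : ∀ n M → n ≤ M → + p ^ M ≡ + p ^ (M ∸ n) ℤ.* + p ^ n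
      p^-split n M n≤M = trans (cong (λ e → + p ^ e) (sym (ℕP.m∸n+n≡m n≤M)))
                           (trans (cong +_ (ℕP.^-distribˡ-+-* p (M ∸ n) n)) (ℤP.pos-* (p ^ (M ∸ n)) (p ^ n)))

    combo≃numerator÷p^ : ∀ cs n M → length cs + n ≤ suc M → (combo p pp a cs n ≃ numerator cs n M ÷ p ^ M) {{p^≢0 M}}
    combo≃numerator÷p^ []       n M _ =
      0ℚ-≃÷ (p ^ M) {{p^≢0 M}}
    combo≃numerator÷p^ (c ∷ cs) n M le =
      ≃÷-+ {{p^≢0 M}}
        (≃÷-rescale {N = c ℤ.* + a n} {M = c ℤ.* + a n ℤ.* + p ^ (M ∸ n)} {{p^≢0 n}} {{p^≢0 M}}
                    (frac-≃÷ (c ℤ.* + a n) n) rescaled)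
        (combo≃numerator÷p^ cs (suc n) M (tail≤ (length cs) n M le))
      where
      rescaled : c ℤ.* + a n ℤ.* + p ^ M ≡ c ℤ.* + a n ℤ.* + p ^ (M ∸ n) ℤ.* + p ^ n
      rescaled = trans (cong (c ℤ.* + a n ℤ.*_) (p^-split n M (head≤ (length cs) n M le)))
                       (sym (ℤP.*-assoc (c ℤ.* + a n) _ _))

    -- Since a_{n+i} ≡ a_M (mod p^{n+i}), each term of the numerator is congruent to c_i a_M p^{M-n-i} modulo p^M.
    numerator≡a*weight : ∀ cs n M → length cs + n ≤ suc M →
                         ∃ λ t → numerator cs n M ≡ + a M ℤ.* weight cs n M ℤ.+ t ℤ.* + p ^ M
    numerator≡a*weight []       n M _ = + 0 , sym (cong₂ ℤ._+_ (ℤP.*-zeroʳ (+ a M)) (ℤP.*-zeroˡ (+ p ^ M)))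
    numerator≡a*weight (c ∷ cs) n M le
      with numerator≡a*weight cs (suc n) M (tail≤ (length cs) n M le) | a-≡-mod n (M ∸ n)
    ... | t , num≡ | s , a[M]≡ =
      t ℤ.- c ℤ.* + s , absorb c (+ a n) (+ s) (+ p ^ n) (+ p ^ (M ∸ n)) _ t _ _ _ num≡ a[M]≡ℤ (p^-split n M n≤M)
      where
      absorb : ∀ c x s P Q W t N A B → N ≡ A ℤ.* W ℤ.+ t ℤ.* B → A ≡ x ℤ.+ s ℤ.* P → B ≡ Q ℤ.* P →
               c ℤ.* x ℤ.* Q ℤ.+ N ≡ A ℤ.* (c ℤ.* Q ℤ.+ W) ℤ.+ (t ℤ.- c ℤ.* s) ℤ.* B
      absorb c x s P Q W t _ _ _ refl refl refl = regroup c x s P Q W t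
        where
        regroup : ∀ c x s P Q W t → c ℤ.* x ℤ.* Q ℤ.+ ((x ℤ.+ s ℤ.* P) ℤ.* W ℤ.+ t ℤ.* (Q ℤ.* P))
                                  ≡ (x ℤ.+ s ℤ.* P) ℤ.* (c ℤ.* Q ℤ.+ W) ℤ.+ (t ℤ.- c ℤ.* s) ℤ.* (Q ℤ.* P)
        regroup = solve-∀
      n≤M = head≤ (length cs) n M le
      a[M]≡ℤ : + a M ≡ + a n ℤ.+ + s ℤ.* + p ^ n
      a[M]≡ℤ = trans (cong (λ i → + a i) (sym (ℕP.m+[n∸m]≡n n≤M)))
                (trans (cong +_ a[M]≡) (trans (ℤP.pos-+ (a n) (s * p ^ n)) (cong (ℤ._+_ (+ a n)) (ℤP.pos-* s (p ^ n)))))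

    p*frac-a[1+m]-frac-a[m]-integral : ∀ m → IsInt (ℕ→ℚ p ℚ.* frac p pp (+ a (suc m)) (suc m) ℚ.- frac p pp (+ a m) m)
    p*frac-a[1+m]-frac-a[m]-integral m with proj₂ canon m
    ... | t , a[1+m]≡ = ≃÷-IsInt⇐ {w = + t} {{p^≢0 m}} (≃÷-- {{p^≢0 m}} p*frac-a[1+m] (frac-≃÷ (+ a m) m)) difference
      where
      cancel-p : ∀ p x P → p ℤ.* x ℤ.* P ≡ x ℤ.* (p ℤ.* P)
      cancel-p = solve-∀
      p*frac-a[1+m] : (ℕ→ℚ p ℚ.* frac p pp (+ a (suc m)) (suc m) ≃ + a (suc m) ÷ p ^ m) {{p^≢0 m}}
      p*frac-a[1+m] = ≃÷-rescale {{p^≢0 (suc m)}} {{p^≢0 m}} (≃÷-*ˡ (+ p) {{p^≢0 (suc m)}} (frac-≃÷ (+ a (suc m)) (suc m)))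
        (trans (cancel-p (+ p) (+ a (suc m)) (+ p ^ m)) (cong (+ a (suc m) ℤ.*_) (sym (ℤP.pos-* p (p ^ m)))))
      difference : + a (suc m) ℤ.- + a m ≡ + t ℤ.* + p ^ m
      difference = begin
        + a (suc m) ℤ.- + a m                 ≡⟨ cong (λ x → + x ℤ.- + a m) a[1+m]≡ ⟩
        + (a m + t * p ^ m) ℤ.- + a m         ≡⟨ cong (ℤ._- + a m) (ℤP.pos-+ (a m) (t * p ^ m)) ⟩
        + a m ℤ.+ + (t * p ^ m) ℤ.- + a m     ≡⟨ cancel (+ a m) (+ (t * p ^ m)) ⟩
        + (t * p ^ m)                         ≡⟨ ℤP.pos-* t (p ^ m) ⟩
        + t ℤ.* + p ^ m                       ∎
        where
        open ≡-Reasoning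
        cancel : ∀ x y → x ℤ.+ y ℤ.- x ≡ y
        cancel = solve-∀

module Prufer where
  open import Level using (0ℓ)
  open Fractions
  open GroupMultiples
  open Valuations
  open CommonDenominator
  open import Data.Nat using (ℕ; zero; suc; _+_; _^_; _∸_; _≤_; _≤?_; s≤s)
  import Data.Nat.Properties as ℕP
  open import Data.Nat.Primality using (Prime)
  open import Data.Integer as ℤ using (ℤ; +_; -[1+_])
  import Data.Integer.Properties as ℤP
  open import Data.Integer.Tactic.RingSolver using (solve-∀)
  open import Data.Rational as ℚ using (ℚ; 0ℚ)
  import Data.Rational.Properties as ℚP
  open import Data.List using (List; []; _∷_; length; replicate; _++_)
  open import Data.Product using (∃; ∃-syntax; _,_; proj₁; proj₂)
  open import Relation.Nullary using (yes; no)
  open import Relation.Binary.PropositionalEquality as ≡ using (_≡_; _≢_; cong; cong₂; subst)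
  open import Algebra.Bundles using (AbelianGroup)

  module PruferQuotient {p : ℕ} (pp : Prime p) {a : ℕ → ℕ} (canon : IsCanonicalSeq p a)
    (k : ℕ) (a≡0 : ∀ j → j ≤ k → a j ≡ 0) (a[1+k]≢0 : a (suc k) ≢ 0) where
    open CanonicalSequence pp canon
    open FirstNonzero k a≡0 a[1+k]≢0
    open Γ-Arithmetic pp canon

    g : ℕ → ℚ
    g n = frac p pp (+ a (suc n + k)) (suc n + k)

    InΓ-shift : ∀ cs r → InΓ p pp a (combo p pp a cs (suc r))
    InΓ-shift cs r = replicate r (+ 0) ++ cs , ≡.sym (combo-zeros++ r cs 1)

    frac-a∈Γ : ∀ c r → InΓ p pp a (frac p pp (c ℤ.* + a (suc r)) (suc r))
    frac-a∈Γ c r = replicate r (+ 0) ++ c ∷ [] , ≡.trans (≡.sym (ℚP.+-identityʳ _)) (proj₂ (InΓ-shift (c ∷ []) r))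

    frac-1*a≡frac-a : ∀ r → frac p pp (+ 1 ℤ.* + a r) r ≡ frac p pp (+ a r) r
    frac-1*a≡frac-a r = cong (λ z → frac p pp z r) (ℤP.*-identityˡ (+ a r))

    g∈Γ : ∀ n → InΓ p pp a (g n)
    g∈Γ n = replicate (n + k) (+ 0) ++ + 1 ∷ [] ,
            ≡.trans (≡.sym (frac-1*a≡frac-a (suc n + k))) (proj₂ (frac-a∈Γ (+ 1) (n + k)))

    p*g[0]-integral : IsInt (ℕ→ℚ p ℚ.* g 0)
    p*g[0]-integral = subst IsInt drop-frac-a[k] (p*frac-a[1+m]-frac-a[m]-integral k)
      where
      drop-frac-a[k] : ℕ→ℚ p ℚ.* g 0 ℚ.- frac p pp (+ a k) k ≡ ℕ→ℚ p ℚ.* g 0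
      drop-frac-a[k] = ≡.trans (cong (λ z → ℕ→ℚ p ℚ.* g 0 ℚ.- frac p pp (+ z) k) (a≡0 k ℕP.≤-refl))
                               (≡.trans (cong (ℚ._-_ (ℕ→ℚ p ℚ.* g 0)) (frac-0 k)) (ℚP.+-identityʳ _))

    p*g[1+n]-g[n]-integral : ∀ n → IsInt (ℕ→ℚ p ℚ.* g (suc n) ℚ.- g n)
    p*g[1+n]-g[n]-integral n = p*frac-a[1+m]-frac-a[m]-integral (suc n + k)

    private
      fits : ∀ {L} j → L ≤ j → L + 1 ≤ suc (suc j + k)
      fits {L} j L≤j = subst (_≤ suc (suc j + k)) (ℕP.+-comm 1 L)
                             (s≤s (ℕP.≤-trans L≤j (ℕP.≤-trans (ℕP.m≤m+n j k) (ℕP.n≤1+n (j + k)))))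

      combo-sum≃ : ∀ j cs ds es → length cs ≤ j → length ds ≤ j → length es ≤ j → let M = suc j + k in
        (combo p pp a cs 1 ℚ.+ combo p pp a ds 1 ℚ.- combo p pp a es 1
          ≃ numerator cs 1 M ℤ.+ numerator ds 1 M ℤ.- numerator es 1 M ÷ p ^ M) {{p^≢0 M}}
      combo-sum≃ j cs ds es cs≤ ds≤ es≤ =
        ≃÷-- {{p^≢0 M}} (≃÷-+ {{p^≢0 M}} (combo≃numerator÷p^ cs 1 M (fits j cs≤)) (combo≃numerator÷p^ ds 1 M (fits j ds≤)))
                        (combo≃numerator÷p^ es 1 M (fits j es≤))
        where M = suc j + k

    weights-divisible : ∀ j cs ds es → length cs ≤ j → length ds ≤ j → length es ≤ j →
      IsInt (combo p pp a cs 1 ℚ.+ combo p pp a ds 1 ℚ.- combo p pp a es 1) →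
      ∃ λ u → weight cs 1 (suc j + k) ℤ.+ weight ds 1 (suc j + k) ℤ.- weight es 1 (suc j + k) ≡ u ℤ.* + p ^ suc j
    weights-divisible j cs ds es cs≤ ds≤ es≤ integral
      with ≃÷-IsInt⇒ {{p^≢0 (suc j + k)}} (combo-sum≃ j cs ds es cs≤ ds≤ es≤) integral
         | numerator≡a*weight cs 1 (suc j + k) (fits j cs≤)
         | numerator≡a*weight ds 1 (suc j + k) (fits j ds≤)
         | numerator≡a*weight es 1 (suc j + k) (fits j es≤)
    ... | w , sum≡ | tc , cs≡ | td , ds≡ | te , es≡ =
      a-cancel-mod-p^ j _ (w ℤ.- tc ℤ.- td ℤ.+ te)
        (cancel (+ a M) (W cs) (W ds) (W es) tc td te (+ p ^ M) w
          (≡.trans (≡.sym (cong₂ ℤ._-_ (cong₂ ℤ._+_ cs≡ ds≡) es≡)) sum≡))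
      where
      M = suc j + k
      W : List ℤ → ℤ
      W cs = weight cs 1 M
      expand : ∀ x c d e tc td te P → x ℤ.* (c ℤ.+ d ℤ.- e) ≡
        (x ℤ.* c ℤ.+ tc ℤ.* P) ℤ.+ (x ℤ.* d ℤ.+ td ℤ.* P) ℤ.- (x ℤ.* e ℤ.+ te ℤ.* P) ℤ.- (tc ℤ.+ td ℤ.- te) ℤ.* P
      expand = solve-∀
      collect : ∀ w tc td te P → w ℤ.* P ℤ.- (tc ℤ.+ td ℤ.- te) ℤ.* P ≡ (w ℤ.- tc ℤ.- td ℤ.+ te) ℤ.* P
      collect = solve-∀
      cancel : ∀ x c d e tc td te P w →
               (x ℤ.* c ℤ.+ tc ℤ.* P) ℤ.+ (x ℤ.* d ℤ.+ td ℤ.* P) ℤ.- (x ℤ.* e ℤ.+ te ℤ.* P) ≡ w ℤ.* P →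
               x ℤ.* (c ℤ.+ d ℤ.- e) ≡ (w ℤ.- tc ℤ.- td ℤ.+ te) ℤ.* P
      cancel x c d e tc td te P w eq =
        ≡.trans (expand x c d e tc td te P) (≡.trans (cong (ℤ._- (tc ℤ.+ td ℤ.- te) ℤ.* P) eq) (collect w tc td te P))

    module Universal (A : AbelianGroup 0ℓ 0ℓ) (b : ℕ → AbelianGroup.Carrier A) (rels : PruferRelations p A b) where
      open AbelianGroup A
      open IntegerMultiples A
      open import Relation.Binary.Reasoning.Setoid setoid

      γ : ℕ → Carrier
      γ zero    = ε
      γ (suc n) = b n

      γ-step : ∀ n → p × γ (suc n) ≈ γ n
      γ-step zero    = trans (sym (mult≈× A p (b 0))) (proj₁ rels)
      γ-step (suc n) = trans (sym (mult≈× A p (b (suc n)))) (proj₂ rels n)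

      h : ℕ → Carrier
      h i = γ (i ∸ k)

      h-step : ∀ i → h i ≈ p × h (suc i)
      h-step i with k ≤? i
      ... | yes k≤i = sym (trans (×-congʳ p (reflexive (cong γ (ℕP.+-∸-assoc 1 k≤i)))) (γ-step (i ∸ k)))
      ... | no  k≰i = begin
        γ (i ∸ k)       ≡⟨ cong γ (ℕP.m≤n⇒m∸n≡0 (ℕP.<⇒≤ i<k)) ⟩
        ε               ≈⟨ ×-ε p ⟨
        p × ε           ≡⟨ cong (λ m → p × γ m) (ℕP.m≤n⇒m∸n≡0 i<k) ⟨
        p × γ (suc i ∸ k) ∎
        where i<k = ℕP.≰⇒> k≰i

      h-descent : ∀ j d → h j ≈ (p ^ d) × h (d + j)
      h-descent j zero    = sym (×-homo-1 (h j))
      h-descent j (suc d) = begin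
        h j                            ≈⟨ h-step j ⟩
        p × h (suc j)                  ≈⟨ ×-congʳ p (h-descent (suc j) d) ⟩
        p × (p ^ d) × h (d + suc j)    ≈⟨ ×-assocˡ _ p (p ^ d) ⟩
        (p ^ suc d) × h (d + suc j)    ≡⟨ cong (λ i → (p ^ suc d) × h i) (ℕP.+-suc d j) ⟩
        (p ^ suc d) × h (suc d + j)    ∎

      h-g : ∀ n → h (suc n + k) ≈ b n
      h-g n = reflexive (cong γ (ℕP.m+n∸n≡m (suc n) k))

      p^[1+j]×h-vanishes : ∀ j → (p ^ suc j) × h (suc j + k) ≈ ε
      p^[1+j]×h-vanishes j = trans (sym (h-descent k (suc j))) (reflexive (cong γ (ℕP.n∸n≡0 k)))

      F : List ℤ → ℕ → Carrier
      F []       n = ε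
      F (c ∷ cs) n = c ⊛ h n ∙ F cs (suc n)

      F≈weight⊛h : ∀ cs n M → length cs + n ≤ suc M → F cs n ≈ weight cs n M ⊛ h M
      F≈weight⊛h []       n M _  = refl
      F≈weight⊛h (c ∷ cs) n M le = begin
        c ⊛ h n ∙ F cs (suc n)               ≈⟨ ∙-cong (⊛-congʳ c h[n]≈) (F≈weight⊛h cs (suc n) M (tail≤ (length cs) n M le)) ⟩
        c ⊛ (p ^ (M ∸ n)) × h M ∙ W ⊛ h M    ≈⟨ ∙-congʳ (⊛-*-× c (p ^ (M ∸ n)) (h M)) ⟨
        (c ℤ.* + p ^ (M ∸ n)) ⊛ h M ∙ W ⊛ h M ≈⟨ ⊛-homo-+ (c ℤ.* + p ^ (M ∸ n)) W (h M) ⟨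
        weight (c ∷ cs) n M ⊛ h M            ∎
        where
        W = weight cs (suc n) M
        h[n]≈ : h n ≈ (p ^ (M ∸ n)) × h M
        h[n]≈ = trans (h-descent n (M ∸ n))
                      (reflexive (cong (λ i → (p ^ (M ∸ n)) × h i) (ℕP.m∸n+n≡m (head≤ (length cs) n M le))))

      F-respects-integral : ∀ cs ds es → IsInt (combo p pp a cs 1 ℚ.+ combo p pp a ds 1 ℚ.- combo p pp a es 1) →
                            F cs 1 ∙ F ds 1 ≈ F es 1
      F-respects-integral cs ds es integral = from-divisibility (weights-divisible j cs ds es cs≤ ds≤ es≤ integral)
        where
        split : ∀ x y z → x ℤ.+ y ≡ x ℤ.+ y ℤ.- z ℤ.+ z
        split = solve-∀
        j = length cs + length ds + length es
        M = suc j + k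
        W : List ℤ → ℤ
        W cs = weight cs 1 M
        cs≤ = ℕP.≤-trans (ℕP.m≤m+n (length cs) (length ds)) (ℕP.m≤m+n _ (length es))
        ds≤ = ℕP.≤-trans (ℕP.m≤n+m (length ds) (length cs)) (ℕP.m≤m+n _ (length es))
        es≤ = ℕP.m≤n+m (length es) (length cs + length ds)
        from-divisibility : (∃ λ u → W cs ℤ.+ W ds ℤ.- W es ≡ u ℤ.* + p ^ suc j) → F cs 1 ∙ F ds 1 ≈ F es 1
        from-divisibility (u , Wcs+Wds-Wes≡) = begin
          F cs 1 ∙ F ds 1
            ≈⟨ ∙-cong (F≈weight⊛h cs 1 M (fits j cs≤)) (F≈weight⊛h ds 1 M (fits j ds≤)) ⟩
          W cs ⊛ h M ∙ W ds ⊛ h M                      ≈⟨ ⊛-homo-+ (W cs) (W ds) (h M) ⟨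
          (W cs ℤ.+ W ds) ⊛ h M                        ≡⟨ cong (_⊛ h M) (split (W cs) (W ds) (W es)) ⟩
          (W cs ℤ.+ W ds ℤ.- W es ℤ.+ W es) ⊛ h M      ≈⟨ ⊛-homo-+ (W cs ℤ.+ W ds ℤ.- W es) (W es) (h M) ⟩
          (W cs ℤ.+ W ds ℤ.- W es) ⊛ h M ∙ W es ⊛ h M  ≡⟨ cong (λ z → z ⊛ h M ∙ W es ⊛ h M) Wcs+Wds-Wes≡ ⟩
          (u ℤ.* + p ^ suc j) ⊛ h M ∙ W es ⊛ h M       ≈⟨ ∙-congʳ (⊛-*-× u (p ^ suc j) (h M)) ⟩
          u ⊛ (p ^ suc j) × h M ∙ W es ⊛ h M           ≈⟨ ∙-congʳ (trans (⊛-congʳ u (p^[1+j]×h-vanishes j)) (⊛-ε u)) ⟩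
          ε ∙ W es ⊛ h M                               ≈⟨ identityˡ _ ⟩
          W es ⊛ h M                                   ≈⟨ F≈weight⊛h es 1 M (fits j es≤) ⟨
          F es 1                                       ∎

      φ-f : (x : ℚ) → InΓ p pp a x → Carrier
      φ-f _ (cs , _) = F cs 1

      φ-respects : ∀ x y (x∈Γ : InΓ p pp a x) (y∈Γ : InΓ p pp a y) → IsInt (x ℚ.- y) → φ-f x x∈Γ ≈ φ-f y y∈Γ
      φ-respects _ _ (cs , ≡.refl) (ds , ≡.refl) integral =
        trans (sym (identityʳ _)) (F-respects-integral cs [] ds (subst (λ x → IsInt (x ℚ.- combo p pp a ds 1))
                                                                       (≡.sym (ℚP.+-identityʳ (combo p pp a cs 1)))
                                                                       integral))

      φ-additive : ∀ x y (x∈Γ : InΓ p pp a x) (y∈Γ : InΓ p pp a y) (x+y∈Γ : InΓ p pp a (x ℚ.+ y)) →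
                   φ-f (x ℚ.+ y) x+y∈Γ ≈ φ-f x x∈Γ ∙ φ-f y y∈Γ
      φ-additive _ _ (cs , ≡.refl) (ds , ≡.refl) (es , sum≡) =
        sym (F-respects-integral cs ds es (subst (λ x → IsInt (x ℚ.- combo p pp a es 1)) (≡.sym sum≡)
                                                 (x-x-integral (combo p pp a es 1))))

      φ : HomΓmodℤ p pp a A
      φ = record { f = φ-f ; respects = φ-respects ; additive = φ-additive }

      F-zeros++ : ∀ r cs m → F (replicate r (+ 0) ++ cs) m ≈ F cs (m + r)
      F-zeros++ zero    cs m = reflexive (cong (F cs) (≡.sym (ℕP.+-identityʳ m)))
      F-zeros++ (suc r) cs m = trans (identityˡ _) (trans (F-zeros++ r cs (suc m)) (reflexive (cong (F cs) (≡.sym (ℕP.+-suc m r)))))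

      φ-g : ∀ n → HomΓmodℤ.f φ (g n) (g∈Γ n) ≈ b n
      φ-g n = begin
        F (replicate (n + k) (+ 0) ++ + 1 ∷ []) 1  ≈⟨ F-zeros++ (n + k) (+ 1 ∷ []) 1 ⟩
        h (suc n + k) ∙ ε ∙ ε                      ≈⟨ trans (identityʳ _) (identityʳ _) ⟩
        h (suc n + k)                              ≈⟨ h-g n ⟩
        b n                                        ∎

      module _ (ψ : HomΓmodℤ p pp a A) (ψ-g : ∀ n → HomΓmodℤ.f ψ (g n) (g∈Γ n) ≈ b n) where
        open HomΓmodℤ ψ
        open import Algebra.Properties.Group group using (inverseˡ-unique; identityˡ-unique)

        f-cong : ∀ {x y} (x∈Γ : InΓ p pp a x) (y∈Γ : InΓ p pp a y) → x ≡ y → f x x∈Γ ≈ f y y∈Γ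
        f-cong {x} x∈Γ y∈Γ ≡.refl = respects x x x∈Γ y∈Γ (x-x-integral x)

        f-0 : ∀ (0∈Γ : InΓ p pp a 0ℚ) → f 0ℚ 0∈Γ ≈ ε
        f-0 0∈Γ = identityˡ-unique _ _ (begin
          f 0ℚ 0∈Γ ∙ f 0ℚ 0∈Γ ≈⟨ additive 0ℚ 0ℚ 0∈Γ 0∈Γ 0+0∈Γ ⟨
          f (0ℚ ℚ.+ 0ℚ) 0+0∈Γ ≈⟨ f-cong 0+0∈Γ 0∈Γ (ℚP.+-identityˡ 0ℚ) ⟩
          f 0ℚ 0∈Γ            ∎)
          where
          0+0∈Γ : InΓ p pp a (0ℚ ℚ.+ 0ℚ)
          0+0∈Γ = subst (InΓ p pp a) (≡.sym (ℚP.+-identityˡ 0ℚ)) 0∈Γ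

        module _ (r : ℕ) where
          X : ℤ → ℚ
          X c = frac p pp (c ℤ.* + a (suc r)) (suc r)

          ψX : ℤ → Carrier
          ψX c = f (X c) (frac-a∈Γ c r)

          X-+ : ∀ c d → X (c ℤ.+ d) ≡ X c ℚ.+ X d
          X-+ c d = ≡.trans (cong (λ z → frac p pp z (suc r)) (ℤP.*-distribʳ-+ (+ a (suc r)) c d))
                            (frac-+ (c ℤ.* + a (suc r)) (d ℤ.* + a (suc r)) (suc r))

          ψX-+ : ∀ c d → ψX (c ℤ.+ d) ≈ ψX c ∙ ψX d
          ψX-+ c d = trans (f-cong _ c+d∈Γ (X-+ c d)) (additive _ _ (frac-a∈Γ c r) (frac-a∈Γ d r) c+d∈Γ)
            where
            c+d∈Γ : InΓ p pp a (X c ℚ.+ X d)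
            c+d∈Γ = subst (InΓ p pp a) (X-+ c d) (frac-a∈Γ (c ℤ.+ d) r)

          ψX-0 : ψX (+ 0) ≈ ε
          ψX-0 = trans (f-cong _ ([] , ≡.refl) (frac-0 (suc r))) (f-0 _)

          ψX-× : ∀ n → ψX (+ n) ≈ n × ψX (+ 1)
          ψX-× zero    = ψX-0
          ψX-× (suc n) = trans (ψX-+ (+ 1) (+ n)) (∙-congˡ (ψX-× n))

          ψX-⊛ : ∀ c → ψX c ≈ c ⊛ ψX (+ 1)
          ψX-⊛ (+ n)    = ψX-× n
          ψX-⊛ -[1+ n ] = trans (inverseˡ-unique _ _ (begin
            ψX -[1+ n ] ∙ ψX (+ suc n)     ≈⟨ ψX-+ -[1+ n ] (+ suc n) ⟨
            ψX (-[1+ n ] ℤ.+ + suc n)      ≡⟨ cong ψX (ℤP.+-inverseˡ (+ suc n)) ⟩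
            ψX (+ 0)                       ≈⟨ ψX-0 ⟩
            ε                              ∎)) (⁻¹-cong (ψX-× (suc n)))

        ψX-1≈h : ∀ r → ψX r (+ 1) ≈ h (suc r)
        ψX-1≈h r with suc r ≤? k
        ... | yes 1+r≤k = begin
          ψX r (+ 1)     ≈⟨ f-cong _ ([] , ≡.refl) X≡0 ⟩
          f 0ℚ ([] , _)  ≈⟨ f-0 _ ⟩
          ε              ≡⟨ cong γ (ℕP.m≤n⇒m∸n≡0 1+r≤k) ⟨
          h (suc r)      ∎
          where
          X≡0 : X r (+ 1) ≡ 0ℚ
          X≡0 = ≡.trans (cong (λ z → frac p pp (+ 1 ℤ.* + z) (suc r)) (a≡0 (suc r) 1+r≤k)) (frac-0 (suc r))
        ... | no  1+r≰k = subst (λ r → ψX r (+ 1) ≈ h (suc r)) (ℕP.m∸n+n≡m k≤r) (ψX-1≈h-beyond (r ∸ k))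
          where
          k≤r = ℕP.≤-pred (ℕP.≰⇒> 1+r≰k)
          ψX-1≈h-beyond : ∀ n → ψX (n + k) (+ 1) ≈ h (suc n + k)
          ψX-1≈h-beyond n = begin
            ψX (n + k) (+ 1)     ≈⟨ f-cong _ (g∈Γ n) (frac-1*a≡frac-a (suc n + k)) ⟩
            f (g n) (g∈Γ n)      ≈⟨ ψ-g n ⟩
            b n                  ≈⟨ h-g n ⟨
            h (suc n + k)        ∎

        f≈F : ∀ cs r → f (combo p pp a cs (suc r)) (InΓ-shift cs r) ≈ F cs (suc r)
        f≈F []       r = f-0 _
        f≈F (c ∷ cs) r = begin
          f (combo p pp a (c ∷ cs) (suc r)) (InΓ-shift (c ∷ cs) r)
            ≈⟨ additive _ _ (frac-a∈Γ c r) (InΓ-shift cs (suc r)) (InΓ-shift (c ∷ cs) r) ⟩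
          ψX r c ∙ f (combo p pp a cs (suc (suc r))) (InΓ-shift cs (suc r))
            ≈⟨ ∙-cong (trans (ψX-⊛ r c) (⊛-congʳ c (ψX-1≈h r))) (f≈F cs (suc r)) ⟩
          c ⊛ h (suc r) ∙ F cs (suc (suc r)) ∎

        f≈φ : ∀ x (x∈Γ : InΓ p pp a x) → f x x∈Γ ≈ HomΓmodℤ.f φ x x∈Γ
        f≈φ x (cs , x≡) = trans (f-cong (cs , x≡) (InΓ-shift cs 0) x≡) (f≈F cs 0)

module FirstNonzeroSearch (a : ℕ → ℕ) where
  open import Data.Nat using (zero; suc; _≤_; _≟_; z≤n)
  import Data.Nat.Properties as ℕP
  open import Data.Product using (_×_; _,_)
  open import Data.Sum using (_⊎_; inj₁; inj₂)
  open import Relation.Nullary using (yes; no; contradiction)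
  open import Relation.Binary.PropositionalEquality using (_≡_; refl)

  zero-prefix-or-first-nonzero : a 0 ≡ 0 → ∀ m →
    (∀ j → j ≤ m → a j ≡ 0) ⊎ ∃ λ k → (∀ j → j ≤ k → a j ≡ 0) × a (suc k) ≢ 0
  zero-prefix-or-first-nonzero a₀≡0 zero = inj₁ λ { .zero z≤n → a₀≡0 }
  zero-prefix-or-first-nonzero a₀≡0 (suc m) with zero-prefix-or-first-nonzero a₀≡0 m
  ... | inj₂ first = inj₂ first
  ... | inj₁ zeros-to-m with a (suc m) ≟ 0
  ...   | no  a[1+m]≢0 = inj₂ (m , zeros-to-m , a[1+m]≢0)
  ...   | yes a[1+m]≡0 = inj₁ zeros-to-1+m
    where
    zeros-to-1+m : ∀ j → j ≤ suc m → a j ≡ 0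
    zeros-to-1+m j j≤1+m with ℕP.m≤n⇒m<n∨m≡n j≤1+m
    ... | inj₁ j<1+m = zeros-to-m j (ℕP.≤-pred j<1+m)
    ... | inj₂ refl  = a[1+m]≡0

  first-nonzero : a 0 ≡ 0 → ∀ {n} → a n ≢ 0 → ∃ λ k → (∀ j → j ≤ k → a j ≡ 0) × a (suc k) ≢ 0
  first-nonzero a₀≡0 {n} aₙ≢0 with zero-prefix-or-first-nonzero a₀≡0 n
  ... | inj₁ zeros = contradiction (zeros n ℕP.≤-refl) aₙ≢0
  ... | inj₂ first = first

open Prufer
open FirstNonzeroSearch using (first-nonzero)

lemma2 : (p : ℕ) (pp : Prime p) (q : ℤₚ p) → NormLt1 q →
         (∃ λ n → canonical q n ≢ 0) →
         Σ (ℕ → ℚ) λ g → Σ (∀ n → InΓ p pp (canonical q) (g n)) λ hg →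
           PresentsPrufer p pp (canonical q) g hg
lemma2 p pp (a , canon) _ (n , aₙ≢0) with first-nonzero a (ℕP.n<1⇒n≡0 (proj₁ canon 0)) aₙ≢0
... | k , a≡0 , a[1+k]≢0 =
  g , g∈Γ , (p*g[0]-integral , p*g[1+n]-g[n]-integral) , λ A b rels →
    let open Universal A b rels in
    (φ , φ-g) , λ ψ χ ψ-g χ-g x x∈Γ →
      AbelianGroup.trans A (f≈φ ψ ψ-g x x∈Γ) (AbelianGroup.sym A (f≈φ χ χ-g x x∈Γ))
  where open PruferQuotient pp canon k a≡0 a[1+k]≢0
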